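{- For every positive integer $n$, the checkerboard graph $R_{2,n}$ is even universal.
   Context: For positive integers $m,n$, the checkerboard graph $R_{m,n}$ has vertex set $\{1,\dots,m\}\times\{1,\dots,n\}$, with $(x_1,x_2)$ adjacent to $(y_1,y_2)$ iff $|x_1-y_1|+|x_2-y_2|=1$. A graph derangement of a graph $G=(V,E)$ is an injective map $f:V\to V$ with $f(v)$ adjacent to $v$ for all $v$. For a finite graph, the cycles of $f$ are its orbits (the equivalence classes of $x\approx y$ iff $f^m(x)=f^n(y)$ for some positive integers $m,n$), and the cycle type of $f$ is the partition of $\#V$ given by the multiset of cycle sizes. A finite graph with $N$ vertices is even universal if every partition of $N$ into even parts is the cycle type of some graph derangement of it. -}

module Defs where

open import Data.Nat using (ℕ; zero; suc; _+_; _*_; _<_; ∣_-_∣)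
open import Data.Nat.Divisibility using (_∣_)
open import Data.Fin using (Fin; toℕ)
open import Data.List using (List; length)
open import Data.Nat.ListAction using (sum)
open import Data.List.Relation.Unary.All using (All)
open import Data.Product using (_×_; Σ; ∃; ∃-syntax; _,_)
open import Function using (_↔_)
open import Function.Definitions using (Injective)
open import Relation.Binary.PropositionalEquality using (_≡_)

-- Checkerboard graph R_{m,n}: vertices {1..m}×{1..n}, encoded 0-indexed as Fin m × Fin n.
Vertex : ℕ → ℕ → Set
Vertex m n = Fin m × Fin n

CheckerAdj : (m n : ℕ) → Vertex m n → Vertex m n → Set
CheckerAdj m n (x₁ , x₂) (y₁ , y₂) = ∣ toℕ x₁ - toℕ y₁ ∣ + ∣ toℕ x₂ - toℕ y₂ ∣ ≡ 1

IsGraphDerangement : {V : Set} → (V → V → Set) → (V → V) → Set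
IsGraphDerangement {V} Adj f = Injective _≡_ _≡_ f × (∀ v → Adj v (f v))

iter : {V : Set} → (V → V) → ℕ → V → V
iter f zero    x = x
iter f (suc k) x = f (iter f k x)

SameCycle : {V : Set} → (V → V) → V → V → Set
SameCycle f x y = ∃[ a ] ∃[ b ] (0 < a × 0 < b × iter f a x ≡ iter f b y)

lookupL : (ps : List ℕ) → Fin (length ps) → ℕ
lookupL ps i = Data.List.lookup ps i

-- f has cycle type ps (a list regarded as a multiset): the cycles of f
-- can be labelled by the positions of ps so that the cycle labelled i
-- has exactly (ps at i) elements.
HasCycleType : {V : Set} → (V → V) → List ℕ → Set
HasCycleType {V} f ps =
  Σ (V → Fin (length ps)) λ c →
    (∀ x y → (SameCycle f x y → c x ≡ c y) × (c x ≡ c y → SameCycle f x y))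
    × (∀ i → Fin (lookupL ps i) ↔ Σ V (λ v → c v ≡ i))

IsEvenPartition : ℕ → List ℕ → Set
IsEvenPartition N ps = All (λ k → 0 < k × 2 ∣ k) ps × sum ps ≡ N

EvenUniversal : (V : Set) → (N : ℕ) → (V → V → Set) → Set
EvenUniversal V N Adj =
  (ps : List ℕ) → IsEvenPartition N ps →
  Σ (V → V) λ f → IsGraphDerangement Adj f × HasCycleType f ps

CheckerboardEvenUniversal : ℕ → ℕ → Set
CheckerboardEvenUniversal m n = EvenUniversal (Vertex m n) (m * n) (CheckerAdj m n)

-- A 2 × k board has a Hamiltonian cycle of length 2k, its boundary: along the first row and back
-- along the second. For an even partition 2k₁ + ⋯ + 2kᵣ = 2n, cut R_{2,n} into consecutive
-- 2 × kᵢ blocks and move every vertex one step along the boundary of its block; the cycles of this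
-- derangement are exactly the block boundaries. A cover by cycles of lengths ps is encoded as a
-- bijection of the vertices with Σ i, Fin (ps i) along which each rotation p ↦ p + 1 (mod ps i)
-- steps between adjacent vertices; the derangement is that rotation transported to the vertices.

module Submission where

open import Defs
open import Data.Nat using (ℕ; _<_)
open import Data.Nat.Base using (zero; suc; _+_; _*_; _∸_; _≤_; z≤n; s≤s; ∣_-_∣; _%_)
open import Data.Nat.Properties
  using (+-identityʳ; +-suc; +-comm; *-comm; *-distribˡ-+; *-cancelˡ-≡; +-cancelˡ-≡; +-cancelˡ-<;
         +-commutativeSemigroup; m≤m+n; m<m+n; <-≤-trans; +-monoʳ-<; m≤n⇒m<n∨m≡n; ≮⇒≥; _<?_;
         m≤n⇒∃[o]m+o≡n; +-∸-assoc; n∸n≡0; ∣n-n∣≡0; ∣-∣-comm; ∣m+n-m+o∣≡∣n-o∣)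
open import Algebra.Properties.CommutativeSemigroup +-commutativeSemigroup using (x∙yz≈y∙xz)
open import Data.Nat.DivMod using (m%n<n; m<n⇒m%n≡m; n%n≡0; [m+n]%n≡m%n; %-distribˡ-+; m%n%n≡m%n)
open import Data.Nat.Divisibility using (divides; _∣_)
open import Data.Fin.Base using (Fin; zero; suc; toℕ; fromℕ<; _↑ˡ_; _↑ʳ_; reduce≥; opposite)
open import Data.Fin.Properties
  using (toℕ-injective; toℕ-fromℕ<; toℕ<n; toℕ-↑ˡ; toℕ-↑ʳ; +↔⊎; splitAt-<; splitAt-≥;
         splitAt⁻¹-↑ʳ; opposite-prop; opposite-involutive)
open import Data.List using (List; []; _∷_; length)
open import Data.Nat.ListAction using (sum)
open import Data.List.Relation.Unary.All as All using (All; []; _∷_)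
open import Data.Product using (Σ; ∃-syntax; _×_; _,_; proj₁; proj₂; map; map₂)
open import Data.Product.Algebra using (×-cong; ×-distribˡ-⊎)
open import Data.Product.Function.Dependent.Propositional using (Σ-↔)
open import Data.Product.Properties using (Σ-≡,≡←≡)
open import Data.Sum using (_⊎_; inj₁; inj₂)
open import Data.Sum.Function.Propositional using (_⊎-↔_)
open import Function using (_∘_; _↔_; Inverse; mk↔ₛ′)
open import Function.Definitions using (Injective)
open import Function.Properties.Inverse using (↔-refl; ↔-sym; ↔-trans)
open import Relation.Nullary using (yes; no)
open import Relation.Binary.PropositionalEquality

iter-suc : ∀ {V : Set} (f : V → V) t x → iter f t (f x) ≡ iter f (suc t) x
iter-suc f zero    x = refl
iter-suc f (suc t) x = cong f (iter-suc f t x)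

rotate : ∀ {m} → Fin m → Fin m
rotate {suc m} i = fromℕ< (m%n<n (suc (toℕ i)) (suc m))

toℕ-rotate : ∀ {m} (i : Fin (suc m)) → toℕ (rotate i) ≡ suc (toℕ i) % suc m
toℕ-rotate {m} i = toℕ-fromℕ< (m%n<n (suc (toℕ i)) (suc m))

toℕ-rotate-< : ∀ {m} (i : Fin m) → suc (toℕ i) < m → toℕ (rotate i) ≡ suc (toℕ i)
toℕ-rotate-< {suc m} i 1+i<m = trans (toℕ-rotate i) (m<n⇒m%n≡m 1+i<m)

toℕ-rotate-last : ∀ {m} (i : Fin m) → suc (toℕ i) ≡ m → toℕ (rotate i) ≡ 0
toℕ-rotate-last {suc m} i 1+i≡m =
  trans (toℕ-rotate i) (trans (cong (_% suc m) 1+i≡m) (n%n≡0 (suc m)))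

toℕ-iter-rotate : ∀ {m} t (i : Fin (suc m)) → toℕ (iter rotate t i) ≡ (toℕ i + t) % suc m
toℕ-iter-rotate {m} zero i =
  sym (trans (cong (_% suc m) (+-identityʳ (toℕ i))) (m<n⇒m%n≡m (toℕ<n i)))
toℕ-iter-rotate {m} (suc t) i = begin
  toℕ (rotate (iter rotate t i))  ≡⟨ toℕ-rotate _ ⟩
  suc (toℕ (iter rotate t i)) % d ≡⟨ cong (λ y → suc y % d) (toℕ-iter-rotate t i) ⟩
  (1 + x % d) % d                 ≡⟨ %-distribˡ-+ 1 (x % d) d ⟩
  (1 % d + x % d % d) % d         ≡⟨ cong (λ y → (1 % d + y) % d) (m%n%n≡m%n x d) ⟩
  (1 % d + x % d) % d             ≡⟨ %-distribˡ-+ 1 x d ⟨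
  suc x % d                       ≡⟨ cong (_% d) (+-suc (toℕ i) t) ⟨
  (toℕ i + suc t) % d             ∎
  where
  open ≡-Reasoning
  d x : ℕ
  d = suc m
  x = toℕ i + t

iter-rotate-period : ∀ {m} (i : Fin m) → iter rotate m i ≡ i
iter-rotate-period {suc m} i = toℕ-injective (begin
  toℕ (iter rotate (suc m) i) ≡⟨ toℕ-iter-rotate (suc m) i ⟩
  (toℕ i + suc m) % suc m     ≡⟨ [m+n]%n≡m%n (toℕ i) (suc m) ⟩
  toℕ i % suc m               ≡⟨ m<n⇒m%n≡m (toℕ<n i) ⟩
  toℕ i                       ∎)
  where open ≡-Reasoning

rotate-injective : ∀ {m} → Injective _≡_ _≡_ (rotate {m})
rotate-injective {suc m} {i} {j} eq = begin
  i                        ≡⟨ iter-rotate-period i ⟨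
  iter rotate (suc m) i    ≡⟨ iter-suc rotate m i ⟨
  iter rotate m (rotate i) ≡⟨ cong (iter rotate m) eq ⟩
  iter rotate m (rotate j) ≡⟨ iter-suc rotate m j ⟩
  iter rotate (suc m) j    ≡⟨ iter-rotate-period j ⟩
  j                        ∎
  where open ≡-Reasoning

-- After toℕ j + m steps from i and toℕ i + m steps from j both reach i + j (mod m).
rotate-sameCycle : ∀ {m} (i j : Fin m) → SameCycle rotate i j
rotate-sameCycle {suc m} i j =
  suc m + toℕ j , suc m + toℕ i , s≤s z≤n , s≤s z≤n ,
  toℕ-injective (begin
    toℕ (iter rotate (suc m + toℕ j) i) ≡⟨ toℕ-iter-rotate _ i ⟩
    (toℕ i + (suc m + toℕ j)) % suc m   ≡⟨ cong (_% suc m) (x∙yz≈y∙xz (toℕ i) (suc m) (toℕ j)) ⟩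
    (suc m + (toℕ i + toℕ j)) % suc m   ≡⟨ cong (λ y → (suc m + y) % suc m) (+-comm (toℕ i) (toℕ j)) ⟩
    (suc m + (toℕ j + toℕ i)) % suc m   ≡⟨ cong (_% suc m) (x∙yz≈y∙xz (toℕ j) (suc m) (toℕ i)) ⟨
    (toℕ j + (suc m + toℕ i)) % suc m   ≡⟨ toℕ-iter-rotate _ j ⟨
    toℕ (iter rotate (suc m + toℕ i) j) ∎)
  where open ≡-Reasoning

Slots : List ℕ → Set
Slots ps = Σ (Fin (length ps)) (Fin ∘ lookupL ps)

rotateSlot : ∀ ps → Slots ps → Slots ps
rotateSlot ps (i , p) = i , rotate p

iter-rotateSlot : ∀ {ps} t (i : Fin (length ps)) p →
                  iter (rotateSlot ps) t (i , p) ≡ (i , iter rotate t p)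
iter-rotateSlot zero    i p = refl
iter-rotateSlot {ps} (suc t) i p = cong (rotateSlot ps) (iter-rotateSlot {ps} t i p)

rotateSlot-injective : ∀ {ps} → Injective _≡_ _≡_ (rotateSlot ps)
rotateSlot-injective {ps} {i , p} {j , q} eq with Σ-≡,≡←≡ {B = Fin ∘ lookupL ps} eq
... | refl , rotate-p≡rotate-q = cong (i ,_) (rotate-injective rotate-p≡rotate-q)

rotateSlot-hasCycleType : ∀ ps → HasCycleType (rotateSlot ps) ps
rotateSlot-hasCycleType ps =
  proj₁ , (λ x y → sameCycle⇒sameLabel x y , sameLabel⇒sameCycle x y) , fibre
  where
  label-iter : ∀ t (z : Slots ps) → proj₁ (iter (rotateSlot ps) t z) ≡ proj₁ z
  label-iter t (i , p) = cong proj₁ (iter-rotateSlot {ps} t i p)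

  sameCycle⇒sameLabel : ∀ x y → SameCycle (rotateSlot ps) x y → proj₁ x ≡ proj₁ y
  sameCycle⇒sameLabel x y (a , b , _ , _ , eq) =
    trans (sym (label-iter a x)) (trans (cong proj₁ eq) (label-iter b y))

  sameLabel⇒sameCycle : ∀ x y → proj₁ x ≡ proj₁ y → SameCycle (rotateSlot ps) x y
  sameLabel⇒sameCycle (i , p) (.i , q) refl with rotate-sameCycle p q
  ... | a , b , 0<a , 0<b , eq =
    a , b , 0<a , 0<b ,
    trans (iter-rotateSlot {ps} a i p) (trans (cong (i ,_) eq) (sym (iter-rotateSlot {ps} b i q)))

  fibre : ∀ i → Fin (lookupL ps i) ↔ Σ (Slots ps) (λ z → proj₁ z ≡ i)
  fibre i = mk↔ₛ′ (λ p → (i , p) , refl) (λ { ((.i , p) , refl) → p })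
                  (λ { ((.i , p) , refl) → refl }) (λ _ → refl)

module _ {V W : Set} (e : V ↔ W) where
  open Inverse e

  conjugate : (W → W) → V → V
  conjugate g = from ∘ g ∘ to

  iter-conjugate : ∀ g t v → iter (conjugate g) t v ≡ from (iter g t (to v))
  iter-conjugate g zero    v = sym (strictlyInverseʳ v)
  iter-conjugate g (suc t) v =
    cong (from ∘ g) (trans (cong to (iter-conjugate g t v)) (strictlyInverseˡ _))

  from-injective : Injective _≡_ _≡_ from
  from-injective {x} {y} eq = trans (sym (strictlyInverseˡ x)) (trans (cong to eq) (strictlyInverseˡ y))

  conjugate-injective : ∀ {g} → Injective _≡_ _≡_ g → Injective _≡_ _≡_ (conjugate g)
  conjugate-injective g-inj {x} {y} eq =
    trans (sym (strictlyInverseʳ x)) (trans (cong from (g-inj (from-injective eq))) (strictlyInverseʳ y))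

  conjugate-hasCycleType : ∀ {g ps} → HasCycleType g ps → HasCycleType (conjugate g) ps
  conjugate-hasCycleType {g} {ps} (c , c-classifies , fibre) = c ∘ to , c∘to-classifies , fibre′
    where
    sameCycle⇒ : ∀ x y → SameCycle (conjugate g) x y → SameCycle g (to x) (to y)
    sameCycle⇒ x y (a , b , 0<a , 0<b , eq) = a , b , 0<a , 0<b ,
      from-injective (trans (sym (iter-conjugate g a x)) (trans eq (iter-conjugate g b y)))

    sameCycle⇐ : ∀ x y → SameCycle g (to x) (to y) → SameCycle (conjugate g) x y
    sameCycle⇐ x y (a , b , 0<a , 0<b , eq) = a , b , 0<a , 0<b ,
      trans (iter-conjugate g a x) (trans (cong from eq) (sym (iter-conjugate g b y)))

    c∘to-classifies : ∀ x y → (SameCycle (conjugate g) x y → c (to x) ≡ c (to y))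
                            × (c (to x) ≡ c (to y) → SameCycle (conjugate g) x y)
    c∘to-classifies x y = proj₁ (c-classifies (to x) (to y)) ∘ sameCycle⇒ x y
                        , sameCycle⇐ x y ∘ proj₂ (c-classifies (to x) (to y))

    fibre′ : ∀ i → Fin (lookupL ps i) ↔ Σ V (λ v → c (to v) ≡ i)
    fibre′ i = ↔-trans (fibre i) (↔-sym (Σ-↔ e ↔-refl))

record CycleCover {V : Set} (Adj : V → V → Set) (ps : List ℕ) : Set where
  field
    slots    : V ↔ Slots ps
    adjacent : ∀ z → Adj (Inverse.from slots z) (Inverse.from slots (rotateSlot ps z))

cycleCover⇒derangement : ∀ {V : Set} {Adj : V → V → Set} {ps} → CycleCover Adj ps →
                         Σ (V → V) λ f → IsGraphDerangement Adj f × HasCycleType f ps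
cycleCover⇒derangement {V} {Adj} {ps} cover =
  f , (conjugate-injective slots (rotateSlot-injective {ps}) , adjacent-f) ,
  conjugate-hasCycleType slots {ps = ps} (rotateSlot-hasCycleType ps)
  where
  open CycleCover cover
  open Inverse slots
  f : V → V
  f = conjugate slots (rotateSlot ps)
  adjacent-f : ∀ v → Adj v (f v)
  adjacent-f v = subst (λ u → Adj u (f v)) (strictlyInverseʳ v) (adjacent (to v))

record HamiltonianCycle {V : Set} (Adj : V → V → Set) (m : ℕ) : Set where
  field
    positions : V ↔ Fin m
    adjacent  : ∀ p → Adj (Inverse.from positions p) (Inverse.from positions (rotate p))

Slots-∷ : ∀ m ps → Slots (m ∷ ps) ↔ (Fin m ⊎ Slots ps)
Slots-∷ m ps = mk↔ₛ′ split unsplit (λ { (inj₁ _) → refl ; (inj₂ _) → refl })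
                                   (λ { (zero , _) → refl ; (suc _ , _) → refl })
  where
  split : Slots (m ∷ ps) → Fin m ⊎ Slots ps
  split (zero  , p) = inj₁ p
  split (suc i , p) = inj₂ (i , p)
  unsplit : Fin m ⊎ Slots ps → Slots (m ∷ ps)
  unsplit (inj₁ p)       = zero , p
  unsplit (inj₂ (i , p)) = suc i , p

↑ˡ-adjacent : ∀ {m k} n (v w : Fin m × Fin k) → CheckerAdj m k v w →
              CheckerAdj m (k + n) (map₂ (_↑ˡ n) v) (map₂ (_↑ˡ n) w)
↑ˡ-adjacent n (_ , j) (_ , j′) adj rewrite toℕ-↑ˡ j n | toℕ-↑ˡ j′ n = adj

↑ʳ-adjacent : ∀ {m} k {n} (v w : Fin m × Fin n) → CheckerAdj m n v w →
              CheckerAdj m (k + n) (map₂ (k ↑ʳ_) v) (map₂ (k ↑ʳ_) w)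
↑ʳ-adjacent k (_ , j) (_ , j′) adj
  rewrite toℕ-↑ʳ k j | toℕ-↑ʳ k j′ | ∣m+n-m+o∣≡∣n-o∣ k (toℕ j) (toℕ j′) = adj

-- The cycle occupies the first k columns and the cover is shifted right past them.
cycleCover-∷ : ∀ {k n m ps} → HamiltonianCycle (CheckerAdj 2 k) m → CycleCover (CheckerAdj 2 n) ps →
               CycleCover (CheckerAdj 2 (k + n)) (m ∷ ps)
cycleCover-∷ {k} {n} {m} {ps} cycle cover = record { slots = slots ; adjacent = adjacent }
  where
  module H = HamiltonianCycle cycle
  module C = CycleCover cover
  open Inverse using (from)
  slots : Vertex 2 (k + n) ↔ Slots (m ∷ ps)
  slots = ↔-trans (×-cong ↔-refl +↔⊎) (↔-trans (×-distribˡ-⊎ _ _ _ _)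
            (↔-trans (H.positions ⊎-↔ C.slots) (↔-sym (Slots-∷ m ps))))
  adjacent : ∀ z → CheckerAdj 2 (k + n) (from slots z) (from slots (rotateSlot (m ∷ ps) z))
  adjacent (zero  , p) =
    ↑ˡ-adjacent n (from H.positions p) (from H.positions (rotate p)) (H.adjacent p)
  adjacent (suc i , p) =
    ↑ʳ-adjacent k (from C.slots (i , p)) (from C.slots (i , rotate p)) (C.adjacent (i , p))

UnitDistance : ℕ × ℕ → ℕ × ℕ → Set
UnitDistance (x₁ , x₂) (y₁ , y₂) = ∣ x₁ - y₁ ∣ + ∣ x₂ - y₂ ∣ ≡ 1

coords : ∀ {m n} → Vertex m n → ℕ × ℕ
coords = map toℕ toℕ

adjacent-via-coords : ∀ {m n} (v w : Vertex m n) {a b} → coords v ≡ a → coords w ≡ b →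
                      UnitDistance a b → CheckerAdj m n v w
adjacent-via-coords v w refl refl d = d

∣n-1+n∣≡1 : ∀ n → ∣ n - suc n ∣ ≡ 1
∣n-1+n∣≡1 zero    = refl
∣n-1+n∣≡1 (suc n) = ∣n-1+n∣≡1 n

x≡k+d⇒1+x≡k+[1+d] : ∀ {x} k d → x ≡ k + d → suc x ≡ k + suc d
x≡k+d⇒1+x≡k+[1+d] k d x≡k+d = trans (cong suc x≡k+d) (sym (+-suc k d))

-- Position j of the boundary cycle of R_{2,k} is (0, j) for j < k and (1, 2k − 1 − j) after that.
rows↔⊎ : ∀ {k} → Vertex 2 k ↔ (Fin k ⊎ Fin k)
rows↔⊎ {k} = mk↔ₛ′ to from to∘from from∘to
  where
  to : Vertex 2 k → Fin k ⊎ Fin k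
  to (zero     , j) = inj₁ j
  to (suc zero , j) = inj₂ (opposite j)
  from : Fin k ⊎ Fin k → Vertex 2 k
  from (inj₁ j) = zero , j
  from (inj₂ j) = suc zero , opposite j
  to∘from : ∀ s → to (from s) ≡ s
  to∘from (inj₁ j) = refl
  to∘from (inj₂ j) = cong inj₂ (opposite-involutive j)
  from∘to : ∀ v → from (to v) ≡ v
  from∘to (zero     , j) = refl
  from∘to (suc zero , j) = cong (suc zero ,_) (opposite-involutive j)

boundaryPositions : ∀ k → Vertex 2 k ↔ Fin (k + k)
boundaryPositions k = ↔-trans rows↔⊎ (↔-sym +↔⊎)

module _ {k : ℕ} where
  open Inverse (boundaryPositions k) using () renaming (from to cell)
  open Inverse (rows↔⊎ {k}) using () renaming (from to cellOfRow)
  open ≡-Reasoning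

  coords-cell-lower : ∀ (p : Fin (k + k)) → toℕ p < k → coords (cell p) ≡ (0 , toℕ p)
  coords-cell-lower p p<k = begin
    coords (cell p)                       ≡⟨ cong (coords ∘ cellOfRow) (splitAt-< k p p<k) ⟩
    (0 , toℕ (fromℕ< p<k))                ≡⟨ cong (0 ,_) (toℕ-fromℕ< p<k) ⟩
    (0 , toℕ p)                           ∎

  coords-cell-upper : ∀ (p : Fin (k + k)) d → toℕ p ≡ k + d → coords (cell p) ≡ (1 , k ∸ suc d)
  coords-cell-upper p d p≡k+d = begin
    coords (cell p)                       ≡⟨ cong (coords ∘ cellOfRow) (splitAt-≥ k p k≤p) ⟩
    (1 , toℕ (opposite (reduce≥ p k≤p)))  ≡⟨ cong (1 ,_) (opposite-prop (reduce≥ p k≤p)) ⟩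
    (1 , k ∸ suc (toℕ (reduce≥ p k≤p)))   ≡⟨ cong (λ x → 1 , k ∸ suc x) toℕ-reduce≥ ⟩
    (1 , k ∸ suc d)                       ∎
    where
    k≤p : k ≤ toℕ p
    k≤p = subst (k ≤_) (sym p≡k+d) (m≤m+n k d)
    toℕ-reduce≥ : toℕ (reduce≥ p k≤p) ≡ d
    toℕ-reduce≥ = +-cancelˡ-≡ k _ _
      (trans (sym (toℕ-↑ʳ k _)) (trans (cong toℕ (splitAt⁻¹-↑ʳ (splitAt-≥ k p k≤p))) p≡k+d))

  lower-row-adjacent : ∀ (p : Fin (k + k)) → toℕ p < k → CheckerAdj 2 k (cell p) (cell (rotate p))
  lower-row-adjacent p p<k with m≤n⇒m<n∨m≡n p<k
  ... | inj₁ 1+p<k = adjacent-via-coords _ _ (coords-cell-lower p p<k)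
          (trans (coords-cell-lower (rotate p) (subst (_< k) (sym rotate-p) 1+p<k)) (cong (0 ,_) rotate-p))
          (∣n-1+n∣≡1 (toℕ p))
    where
    rotate-p : toℕ (rotate p) ≡ suc (toℕ p)
    rotate-p = toℕ-rotate-< p (<-≤-trans 1+p<k (m≤m+n k k))
  ... | inj₂ 1+p≡k = adjacent-via-coords _ _ (coords-cell-lower p p<k)
          (trans (coords-cell-upper (rotate p) 0 rotate-p) (cong (λ x → 1 , x ∸ 1) (sym 1+p≡k)))
          (cong suc (∣n-n∣≡0 (toℕ p)))
    where
    0<k : 0 < k
    0<k = subst (0 <_) 1+p≡k (s≤s z≤n)
    rotate-p : toℕ (rotate p) ≡ k + 0
    rotate-p = trans (toℕ-rotate-< p (subst (_< k + k) (sym 1+p≡k) (m<m+n k 0<k)))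
                     (trans 1+p≡k (sym (+-identityʳ k)))

  upper-row-adjacent : ∀ (p : Fin (k + k)) d → toℕ p ≡ k + d → d < k →
                       CheckerAdj 2 k (cell p) (cell (rotate p))
  upper-row-adjacent p d p≡k+d d<k with m≤n⇒m<n∨m≡n d<k
  ... | inj₁ 1+d<k = adjacent-via-coords _ _ (coords-cell-upper p d p≡k+d)
          (coords-cell-upper (rotate p) (suc d) rotate-p)
          (begin
            ∣ k ∸ suc d - y ∣    ≡⟨ cong (λ x → ∣ x - y ∣) (+-∸-assoc 1 1+d<k) ⟩
            ∣ suc y - y ∣        ≡⟨ ∣-∣-comm (suc y) y ⟩
            ∣ y - suc y ∣        ≡⟨ ∣n-1+n∣≡1 y ⟩
            1                    ∎)
    where
    y : ℕ
    y = k ∸ suc (suc d)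
    1+p≡k+[1+d] : suc (toℕ p) ≡ k + suc d
    1+p≡k+[1+d] = x≡k+d⇒1+x≡k+[1+d] k d p≡k+d
    rotate-p : toℕ (rotate p) ≡ k + suc d
    rotate-p = trans (toℕ-rotate-< p (subst (_< k + k) (sym 1+p≡k+[1+d]) (+-monoʳ-< k 1+d<k))) 1+p≡k+[1+d]
  ... | inj₂ 1+d≡k = adjacent-via-coords _ _
          (trans (coords-cell-upper p d p≡k+d) (trans (cong (λ x → 1 , k ∸ x) 1+d≡k) (cong (1 ,_) (n∸n≡0 k))))
          (trans (coords-cell-lower (rotate p) (subst (_< k) (sym rotate-p) 0<k)) (cong (0 ,_) rotate-p))
          refl
    where
    0<k : 0 < k
    0<k = subst (0 <_) 1+d≡k (s≤s z≤n)
    rotate-p : toℕ (rotate p) ≡ 0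
    rotate-p = toℕ-rotate-last p (trans (x≡k+d⇒1+x≡k+[1+d] k d p≡k+d) (cong (k +_) 1+d≡k))

  cell-adjacent : ∀ (p : Fin (k + k)) → CheckerAdj 2 k (cell p) (cell (rotate p))
  cell-adjacent p with toℕ p <? k
  ... | yes p<k = lower-row-adjacent p p<k
  ... | no p≮k with m≤n⇒∃[o]m+o≡n (≮⇒≥ p≮k)
  ...   | d , k+d≡p = upper-row-adjacent p d (sym k+d≡p)
            (+-cancelˡ-< k d k (subst (_< k + k) (sym k+d≡p) (toℕ<n p)))

boundaryCycle : ∀ k → HamiltonianCycle (CheckerAdj 2 k) (k + k)
boundaryCycle k = record { positions = boundaryPositions k ; adjacent = cell-adjacent {k} }

emptyCover : CycleCover (CheckerAdj 2 0) []
emptyCover = record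
  { slots    = mk↔ₛ′ (λ { (_ , ()) }) (λ { (() , _) }) (λ { (() , _) }) (λ { (_ , ()) })
  ; adjacent = λ { (() , _) }
  }

evenPartition⇒cycleCover : ∀ ps → All (2 ∣_) ps →
                           ∃[ n ] sum ps ≡ 2 * n × CycleCover (CheckerAdj 2 n) ps
evenPartition⇒cycleCover []       []                          = 0 , refl , emptyCover
evenPartition⇒cycleCover (m ∷ ps) (divides q m≡q*2 ∷ evens) with evenPartition⇒cycleCover ps evens
... | n , sum≡2n , cover = q + n , sum≡2[q+n] , cycleCover-∷ block cover
  where
  open ≡-Reasoning
  m≡q+q : m ≡ q + q
  m≡q+q = trans m≡q*2 (trans (*-comm q 2) (cong (q +_) (+-identityʳ q)))
  block : HamiltonianCycle (CheckerAdj 2 q) m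
  block = subst (HamiltonianCycle (CheckerAdj 2 q)) (sym m≡q+q) (boundaryCycle q)
  sum≡2[q+n] : m + sum ps ≡ 2 * (q + n)
  sum≡2[q+n] = begin
    m + sum ps    ≡⟨ cong₂ _+_ m≡q*2 sum≡2n ⟩
    q * 2 + 2 * n ≡⟨ cong (_+ 2 * n) (*-comm q 2) ⟩
    2 * q + 2 * n ≡⟨ *-distribˡ-+ 2 q n ⟨
    2 * (q + n)   ∎

proposition17 : (n : ℕ) → 0 < n → CheckerboardEvenUniversal 2 n
proposition17 n _ ps (parts , sum≡2n) with evenPartition⇒cycleCover ps (All.map proj₂ parts)
... | n′ , sum≡2n′ , cover =
  cycleCover⇒derangement (subst (λ l → CycleCover (CheckerAdj 2 l) ps) n′≡n cover)
  where
  n′≡n : n′ ≡ n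
  n′≡n = *-cancelˡ-≡ n′ n 2 (trans (sym sum≡2n′) sum≡2n)
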